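{- Let $A_1,\dots,A_{2t}\subseteq[u]$ be sets of keys. The number of $2t$-tuples $(x_1,\dots,x_{2t})\in A_1\times\cdots\times A_{2t}$ such that $x_1\oplus\cdots\oplus x_{2t}=\emptyset$ is at most $((2t-1)!!)^c\prod_{i=1}^{2t}\sqrt{|A_i|}$, where $(2t-1)!!=(2t-1)(2t-3)\cdots3\cdot1$.
   Context: Keys $x\in[u]$ are vectors $(x_0,\dots,x_{c-1})$ of $c$ characters from an alphabet $\Sigma$. A position character is an element of $[c]\times\Sigma$, and a key $x$ is identified with the set of its $c$ position characters $\{(0,x_0),\dots,(c-1,x_{c-1})\}$. For keys $x_1,\dots,x_m$, $x_1\oplus\cdots\oplus x_m$ denotes the symmetric difference of their sets of position characters; thus $x_1\oplus\cdots\oplus x_{2t}=\emptyset$ means every position character occurs an even number of times among $x_1,\dots,x_{2t}$. -}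

module Defs where

open import Data.Nat using (ℕ; zero; suc; _+_; _*_; _%_)
open import Data.Nat.Properties using () renaming (_≟_ to _≟ℕ_)
open import Data.Fin using (Fin; zero; suc)
open import Data.Fin.Properties using (all?) renaming (_≟_ to _≟F_)
open import Data.Vec using (Vec; []; _∷_; lookup; toList)
open import Data.List using (List; []; _∷_; map; length; filter; concatMap; tabulate)
open import Data.Nat.ListAction using (product)
open import Relation.Nullary using (Dec)
open import Relation.Binary.PropositionalEquality using (_≡_)

-- The alphabet Σ is Fin σ; a key is a vector of c characters.
Key : ℕ → ℕ → Set
Key σ c = Vec (Fin σ) c

-- All tuples in A 0 × A 1 × ... × A (n-1), as a list (with multiplicity
-- given by the lists).
tuples : ∀ {n} {K : Set} → (Fin n → List K) → List (Vec K n)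
tuples {zero}  A = [] ∷ []
tuples {suc n} A = concatMap (λ x → map (x ∷_) (tuples (λ i → A (suc i)))) (A zero)

mult : ∀ {σ c n} → Vec (Key σ c) n → Fin c → Fin σ → ℕ
mult xs j a = length (filter (λ x → lookup x j ≟F a) (toList xs))

-- x_1 ⊕ ... ⊕ x_n = ∅ : every position character occurs an even number of times
XorEmpty : ∀ {σ c n} → Vec (Key σ c) n → Set
XorEmpty {σ} {c} xs = ∀ (j : Fin c) (a : Fin σ) → mult xs j a % 2 ≡ 0

xorEmpty? : ∀ {σ c n} (xs : Vec (Key σ c) n) → Dec (XorEmpty xs)
xorEmpty? xs = all? (λ j → all? (λ a → (mult xs j a % 2) ≟ℕ 0))

zeroTupleCount : ∀ {σ c n} → (Fin n → List (Key σ c)) → ℕ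
zeroTupleCount A = length (filter xorEmpty? (tuples A))

oddDoubleFact : ℕ → ℕ
oddDoubleFact zero    = 1
oddDoubleFact (suc t) = (2 * t + 1) * oddDoubleFact t

sizeProduct : ∀ {n} {K : Set} → (Fin n → List K) → ℕ
sizeProduct {n} A = product (tabulate {n = n} (λ i → length (A i)))

-- Induction on the number c of characters. Split every key into its first character and the rest.
-- If x₁ ⊕ ⋯ ⊕ xₙ = ∅, the word a of first characters pairs up into equal letters, so the count is at
-- most ∑ₐ m(a) N(a), with m(a) the number of such pairings of a and N(a) the count for the tails of
-- the keys whose first characters spell a. Expanding m(a) by the partner of position 0 and applying
-- Cauchy–Schwarz over the letter shared by the pair shows, by induction on n, that
-- (∑ₐ m(a) N(a))² ≤ ((n−1)!!)² K ∏ᵢ |Aᵢ| as soon as N(a)² ≤ K ∏ᵢ |{x ∈ Aᵢ : x₀ = aᵢ}|, which is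
-- the induction hypothesis on c. For c = 0 each Aᵢ has at most one element.

module Submission where

open import Defs
open import Data.Nat using (ℕ; zero; suc; _+_; _*_; _^_; _%_; _≤_; z≤n; s≤s)
open import Data.Nat.Properties
open import Data.Nat.DivMod using ([m+kn]%n≡m%n)
open import Data.Nat.Tactic.RingSolver using (solve-∀; solve)
open import Data.Bool using (true; false; if_then_else_)
open import Data.Fin using (Fin; zero; suc; punchIn)
open import Data.Fin.Properties using () renaming (_≟_ to _≟F_)
open import Data.Vec as V using (Vec; []; _∷_; lookup; head; tail; insertAt; removeAt; count)
open import Data.Vec.Properties using (insertAt-lookup; insertAt-punchIn; removeAt-insertAt)
open import Data.List as L using (List; []; _∷_; map; length; filter; _++_)
open import Data.List.Properties using (length-map; length-filter)
open import Data.List.Relation.Unary.All using (All; []; _∷_)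
open import Data.List.Relation.Unary.All.Properties using (all-filter)
open import Data.List.Relation.Unary.AllPairs using ([]; _∷_)
open import Data.List.Relation.Unary.Unique.Propositional using (Unique)
open import Data.List.Relation.Unary.Unique.Propositional.Properties using (filter⁺; map⁻)
open import Data.Product using (∃; _,_)
open import Data.Sum using ([_,_]′)
open import Data.Empty using (⊥-elim)
open import Relation.Nullary using (Dec; does; yes; no)
open import Relation.Unary using (Pred; Decidable)
open import Relation.Binary.PropositionalEquality
open import Algebra.Properties.Semiring.Sum +-*-semiring
  using (sum; sum-syntax; sum-cong-≗; sum-replicate-zero; ∑-distrib-+; ∑-comm; *-distribˡ-sum; *-distribʳ-sum)
open import Algebra.Properties.CommutativeMonoid.Sum *-1-commutativeMonoid
  using () renaming (sum to ∏; sum-cong-≗ to ∏-cong; sum-remove to ∏-remove)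

m*m≤n*n⇒m≤n : ∀ {m n} → m * m ≤ n * n → m ≤ n
m*m≤n*n⇒m≤n {m} {n} mm≤nn with m ≤? n
... | yes m≤n = m≤n
... | no m≰n = ⊥-elim (<⇒≱ (*-mono-< n<m n<m) mm≤nn)
  where n<m = ≰⇒> m≰n

4*m*n≤[m+n]² : ∀ m n → 4 * (m * n) ≤ (m + n) * (m + n)
4*m*n≤[m+n]² m n = [ ordered , (λ n≤m → subst₂ _≤_ (cong (4 *_) (*-comm n m))
                                                  (cong (λ s → s * s) (+-comm n m)) (ordered n≤m)) ]′ (≤-total m n)
  where
  gap : ∀ m d → 4 * (m * (m + d)) + d * d ≡ (m + (m + d)) * (m + (m + d))
  gap = solve-∀
  ordered : ∀ {m n} → m ≤ n → 4 * (m * n) ≤ (m + n) * (m + n)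
  ordered {m} m≤n with d , refl ← m≤n⇒∃[o]m+o≡n m≤n = subst (4 * (m * (m + d)) ≤_) (gap m d) (m≤m+n _ (d * d))

am-gm : ∀ y p q → y * y ≤ p * q → 2 * y ≤ p + q
am-gm y p q y²≤pq = m*m≤n*n⇒m≤n (begin
  (2 * y) * (2 * y) ≡⟨ solve L.[ y ] ⟩
  4 * (y * y)       ≤⟨ *-monoʳ-≤ 4 y²≤pq ⟩
  4 * (p * q)       ≤⟨ 4*m*n≤[m+n]² p q ⟩
  (p + q) * (p + q) ∎)
  where open ≤-Reasoning

iverson : ∀ {p} {P : Set p} → Dec P → ℕ
iverson d = if does d then 1 else 0

iverson-≟-sym : ∀ {σ} (α β : Fin σ) → iverson (α ≟F β) ≡ iverson (β ≟F α)
iverson-≟-sym α β with α ≟F β | β ≟F α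
... | yes _    | yes _    = refl
... | no _     | no _     = refl
... | yes refl | no β≢α   = ⊥-elim (β≢α refl)
... | no α≢β   | yes refl = ⊥-elim (α≢β refl)

≡⇒iverson-≟≡1 : ∀ {σ} {α β : Fin σ} → α ≡ β → iverson (α ≟F β) ≡ 1
≡⇒iverson-≟≡1 {α = α} refl with α ≟F α
... | yes _   = refl
... | no α≢α = ⊥-elim (α≢α refl)

∑-select : ∀ {σ} (β : Fin σ) (f : Fin σ → ℕ) → ∑[ α < σ ] (iverson (β ≟F α) * f α) ≡ f β
∑-select {suc σ} zero f = begin
  f zero + 0 + ∑[ α < σ ] 0 ≡⟨ cong (f zero + 0 +_) (sum-replicate-zero σ) ⟩
  f zero + 0 + 0           ≡⟨ +-identityʳ _ ⟩
  f zero + 0               ≡⟨ +-identityʳ _ ⟩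
  f zero                   ∎
  where open ≡-Reasoning
∑-select {suc σ} (suc β) f = ∑-select β (λ α → f (suc α))

term≤∑ : ∀ {σ} (f : Fin σ → ℕ) i → f i ≤ sum f
term≤∑ f zero    = m≤m+n _ _
term≤∑ f (suc i) = ≤-trans (term≤∑ (λ j → f (suc j)) i) (m≤n+m _ _)

∑-1 : ∀ n → ∑[ i < n ] 1 ≡ n
∑-1 zero    = refl
∑-1 (suc n) = cong suc (∑-1 n)

∑-cauchy-schwarz : ∀ {σ} (M g h : Fin σ → ℕ) X → (∀ α → M α * M α ≤ X * (g α * h α)) →
                   sum M * sum M ≤ X * (sum g * sum h)
∑-cauchy-schwarz {zero}  M g h X M²≤ = z≤n
∑-cauchy-schwarz {suc σ} M g h X M²≤ = begin
  (m₀ + S) * (m₀ + S)                           ≡⟨ expand m₀ S ⟩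
  m₀ * m₀ + (2 * (m₀ * S) + S * S)              ≤⟨ +-mono-≤ (M²≤ zero) (+-mono-≤ cross S²≤) ⟩
  X * (g₀ * h₀) + ((X * (g₀ * H) + X * (G * h₀)) + X * (G * H))
                                                ≡⟨ collect X g₀ h₀ G H ⟩
  X * ((g₀ + G) * (h₀ + H))                     ∎
  where
  open ≤-Reasoning
  m₀ = M zero
  g₀ = g zero
  h₀ = h zero
  S = sum (λ i → M (suc i))
  G = sum (λ i → g (suc i))
  H = sum (λ i → h (suc i))
  expand : ∀ m s → (m + s) * (m + s) ≡ m * m + (2 * (m * s) + s * s)
  expand = solve-∀
  collect : ∀ x g₀ h₀ g h → x * (g₀ * h₀) + ((x * (g₀ * h) + x * (g * h₀)) + x * (g * h))
                            ≡ x * ((g₀ + g) * (h₀ + h))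
  collect = solve-∀
  regroup : ∀ m s → (m * s) * (m * s) ≡ (m * m) * (s * s)
  regroup = solve-∀
  swap : ∀ x g₀ h₀ g h → (x * (g₀ * h₀)) * (x * (g * h)) ≡ (x * (g₀ * h)) * (x * (g * h₀))
  swap = solve-∀
  S²≤ : S * S ≤ X * (G * H)
  S²≤ = ∑-cauchy-schwarz (λ i → M (suc i)) (λ i → g (suc i)) (λ i → h (suc i)) X (λ α → M²≤ (suc α))
  cross : 2 * (m₀ * S) ≤ X * (g₀ * H) + X * (G * h₀)
  cross = am-gm (m₀ * S) (X * (g₀ * H)) (X * (G * h₀)) (begin
    (m₀ * S) * (m₀ * S)               ≡⟨ regroup m₀ S ⟩
    (m₀ * m₀) * (S * S)               ≤⟨ *-mono-≤ (M²≤ zero) S²≤ ⟩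
    (X * (g₀ * h₀)) * (X * (G * H))   ≡⟨ swap X g₀ h₀ G H ⟩
    (X * (g₀ * H)) * (X * (G * h₀))   ∎)

∑-square-bound : ∀ {n} (T : Fin n → ℕ) B → (∀ j → T j * T j ≤ B) → sum T * sum T ≤ n * n * B
∑-square-bound {n} T B T²≤ = begin
  sum T * sum T
    ≤⟨ ∑-cauchy-schwarz T one one B (λ j → ≤-trans (T²≤ j) (≤-reflexive (sym (*-identityʳ B)))) ⟩
  B * (∑[ i < n ] 1 * ∑[ i < n ] 1)
    ≡⟨ cong (λ k → B * (k * k)) (∑-1 n) ⟩
  B * (n * n)
    ≡⟨ *-comm B (n * n) ⟩
  n * n * B
    ∎
  where
  open ≤-Reasoning
  one : Fin n → ℕ
  one _ = 1

∑ᵛ : ∀ {σ} n → (Vec (Fin σ) n → ℕ) → ℕ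
∑ᵛ         zero    F = F []
∑ᵛ {σ = σ} (suc n) F = ∑[ α < σ ] ∑ᵛ n (λ v → F (α ∷ v))

module _ {σ : ℕ} where

  ∑ᵛ-cong : ∀ n {F G : Vec (Fin σ) n → ℕ} → (∀ v → F v ≡ G v) → ∑ᵛ n F ≡ ∑ᵛ n G
  ∑ᵛ-cong zero    F≡G = F≡G []
  ∑ᵛ-cong (suc n) F≡G = sum-cong-≗ (λ α → ∑ᵛ-cong n (λ v → F≡G (α ∷ v)))

  ∑ᵛ-*ˡ : ∀ n k (F : Vec (Fin σ) n → ℕ) → ∑ᵛ n (λ v → k * F v) ≡ k * ∑ᵛ n F
  ∑ᵛ-*ˡ zero    k F = refl
  ∑ᵛ-*ˡ (suc n) k F = trans (sum-cong-≗ (λ α → ∑ᵛ-*ˡ n k (λ v → F (α ∷ v))))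
                            (sym (*-distribˡ-sum k (λ α → ∑ᵛ n (λ v → F (α ∷ v)))))

  ∑ᵛ-∑-comm : ∀ {τ} n (F : Vec (Fin σ) n → Fin τ → ℕ) →
              ∑ᵛ n (λ v → ∑[ j < τ ] F v j) ≡ ∑[ j < τ ] ∑ᵛ n (λ v → F v j)
  ∑ᵛ-∑-comm zero    F = refl
  ∑ᵛ-∑-comm (suc n) F = trans (sum-cong-≗ (λ α → ∑ᵛ-∑-comm n (λ v → F (α ∷ v))))
                              (∑-comm (λ α j → ∑ᵛ n (λ v → F (α ∷ v) j)))

  ∑ᵛ-fix : ∀ m (j : Fin (suc m)) (α : Fin σ) (F : Vec (Fin σ) (suc m) → ℕ) →
           ∑ᵛ (suc m) (λ v → iverson (lookup v j ≟F α) * F v) ≡ ∑ᵛ m (λ b → F (insertAt b j α))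
  ∑ᵛ-fix m zero α F = begin
    ∑[ β < σ ] ∑ᵛ m (λ v → iverson (β ≟F α) * F (β ∷ v))
      ≡⟨ sum-cong-≗ (λ β → ∑ᵛ-*ˡ m (iverson (β ≟F α)) (λ v → F (β ∷ v))) ⟩
    ∑[ β < σ ] (iverson (β ≟F α) * ∑ᵛ m (λ v → F (β ∷ v)))
      ≡⟨ sum-cong-≗ (λ β → cong (_* ∑ᵛ m (λ v → F (β ∷ v))) (iverson-≟-sym β α)) ⟩
    ∑[ β < σ ] (iverson (α ≟F β) * ∑ᵛ m (λ v → F (β ∷ v)))
      ≡⟨ ∑-select α (λ β → ∑ᵛ m (λ v → F (β ∷ v))) ⟩
    ∑ᵛ m (λ v → F (α ∷ v))
      ∎
    where open ≡-Reasoning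
  ∑ᵛ-fix (suc m) (suc j) α F = sum-cong-≗ (λ β → ∑ᵛ-fix m j α (λ v → F (β ∷ v)))

perfectMatchings : ℕ → ℕ
perfectMatchings zero          = 1
perfectMatchings (suc zero)    = 0
perfectMatchings (suc (suc m)) = suc m * perfectMatchings m

perfectMatchings-even : ∀ t → perfectMatchings (2 * t) ≡ oddDoubleFact t
perfectMatchings-even zero    = refl
perfectMatchings-even (suc t) = begin
  perfectMatchings (2 * suc t)           ≡⟨ cong perfectMatchings (*-suc 2 t) ⟩
  suc (2 * t) * perfectMatchings (2 * t) ≡⟨ cong₂ _*_ (+-comm 1 (2 * t)) (perfectMatchings-even t) ⟩
  (2 * t + 1) * oddDoubleFact t          ∎
  where open ≡-Reasoning

-- Perfect matchings of the positions of a word that pair equal letters only;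
-- position 0 is paired with position j + 1.
letterMatchings : ∀ {σ n} → Vec (Fin σ) n → ℕ
letterMatchings {n = zero}        []      = 1
letterMatchings {n = suc zero}    _       = 0
letterMatchings {n = suc (suc m)} (α ∷ v) =
  ∑[ j < suc m ] (iverson (lookup v j ≟F α) * letterMatchings (removeAt v j))

∏-insertAt : ∀ {σ m} (g : Fin (suc m) → Fin σ → ℕ) (b : Vec (Fin σ) m) j α →
             ∏ (λ i → g i (lookup (insertAt b j α) i)) ≡ g j α * ∏ (λ i → g (punchIn j i) (lookup b i))
∏-insertAt g b j α = begin
  ∏ (λ i → g i (lookup (insertAt b j α) i))
    ≡⟨ ∏-remove {i = j} (λ i → g i (lookup (insertAt b j α) i)) ⟩
  g j (lookup (insertAt b j α) j) * ∏ (λ i → g (punchIn j i) (lookup (insertAt b j α) (punchIn j i)))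
    ≡⟨ cong₂ _*_ (cong (g j) (insertAt-lookup b j α))
                 (∏-cong (λ i → cong (g (punchIn j i)) (insertAt-punchIn b j α i))) ⟩
  g j α * ∏ (λ i → g (punchIn j i) (lookup b i))
    ∎
  where open ≡-Reasoning

∑ᵛ-letterMatchings-split : ∀ {σ} m (N : Vec (Fin σ) (suc (suc m)) → ℕ) →
  ∑ᵛ (suc (suc m)) (λ a → letterMatchings a * N a) ≡
  ∑[ j < suc m ] ∑[ α < σ ] ∑ᵛ m (λ b → letterMatchings b * N (α ∷ insertAt b j α))
∑ᵛ-letterMatchings-split {σ} m N = begin
  ∑[ α < σ ] ∑ᵛ (suc m) (λ v → ∑[ j < suc m ] (ι v j α * letterMatchings (removeAt v j)) * N (α ∷ v))
    ≡⟨ sum-cong-≗ (λ α → ∑ᵛ-cong (suc m) (λ v → distribute v α)) ⟩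
  ∑[ α < σ ] ∑ᵛ (suc m) (λ v → ∑[ j < suc m ] (ι v j α * (letterMatchings (removeAt v j) * N (α ∷ v))))
    ≡⟨ sum-cong-≗ (λ α → ∑ᵛ-∑-comm (suc m) (λ v j → ι v j α * (letterMatchings (removeAt v j) * N (α ∷ v)))) ⟩
  ∑[ α < σ ] ∑[ j < suc m ] ∑ᵛ (suc m) (λ v → ι v j α * (letterMatchings (removeAt v j) * N (α ∷ v)))
    ≡⟨ sum-cong-≗ (λ α → sum-cong-≗ (λ j → fix α j)) ⟩
  ∑[ α < σ ] ∑[ j < suc m ] ∑ᵛ m (λ b → letterMatchings b * N (α ∷ insertAt b j α))
    ≡⟨ ∑-comm (λ α j → ∑ᵛ m (λ b → letterMatchings b * N (α ∷ insertAt b j α))) ⟩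
  ∑[ j < suc m ] ∑[ α < σ ] ∑ᵛ m (λ b → letterMatchings b * N (α ∷ insertAt b j α))
    ∎
  where
  open ≡-Reasoning
  ι : Vec (Fin σ) (suc m) → Fin (suc m) → Fin σ → ℕ
  ι v j α = iverson (lookup v j ≟F α)
  distribute : ∀ v α → ∑[ j < suc m ] (ι v j α * letterMatchings (removeAt v j)) * N (α ∷ v) ≡
                       ∑[ j < suc m ] (ι v j α * (letterMatchings (removeAt v j) * N (α ∷ v)))
  distribute v α = trans (*-distribʳ-sum (N (α ∷ v)) (λ j → ι v j α * letterMatchings (removeAt v j)))
                         (sum-cong-≗ (λ j → *-assoc (ι v j α) (letterMatchings (removeAt v j)) (N (α ∷ v))))
  fix : ∀ α j → ∑ᵛ (suc m) (λ v → ι v j α * (letterMatchings (removeAt v j) * N (α ∷ v))) ≡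
                ∑ᵛ m (λ b → letterMatchings b * N (α ∷ insertAt b j α))
  fix α j = trans (∑ᵛ-fix m j α (λ v → letterMatchings (removeAt v j) * N (α ∷ v)))
                  (∑ᵛ-cong m (λ b → cong (λ w → letterMatchings w * N (α ∷ insertAt b j α))
                                         (removeAt-insertAt b j α)))

letterMatchings-bound : ∀ {σ} n K (g : Fin n → Fin σ → ℕ) (N : Vec (Fin σ) n → ℕ) →
  (∀ a → N a * N a ≤ K * ∏ (λ i → g i (lookup a i))) →
  ∑ᵛ n (λ a → letterMatchings a * N a) * ∑ᵛ n (λ a → letterMatchings a * N a) ≤
  perfectMatchings n * perfectMatchings n * K * ∏ (λ i → sum (g i))
letterMatchings-bound zero K g N N²≤ =
  subst₂ _≤_ (sym (cong (λ x → x * x) (+-identityʳ (N []))))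
             (cong (_* 1) (sym (*-identityˡ K))) (N²≤ [])
letterMatchings-bound {σ} (suc zero) K g N N²≤ =
  subst (λ x → x * x ≤ 0) (sym (sum-replicate-zero σ)) z≤n
letterMatchings-bound {σ} (suc (suc m)) K g N N²≤ = begin
  ∑ᵛ (suc (suc m)) (λ a → letterMatchings a * N a) * ∑ᵛ (suc (suc m)) (λ a → letterMatchings a * N a)
    ≡⟨ cong (λ x → x * x) (∑ᵛ-letterMatchings-split m N) ⟩
  sum T * sum T
    ≤⟨ ∑-square-bound T B T²≤ ⟩
  suc m * suc m * B
    ≡⟨ regroup (suc m) (perfectMatchings m) K (∏ (λ i → sum (g i))) ⟩
  perfectMatchings (suc (suc m)) * perfectMatchings (suc (suc m)) * K * ∏ (λ i → sum (g i))
    ∎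
  where
  open ≤-Reasoning
  T : Fin (suc m) → ℕ
  T j = ∑[ α < σ ] ∑ᵛ m (λ b → letterMatchings b * N (α ∷ insertAt b j α))
  B = perfectMatchings m * perfectMatchings m * K * ∏ (λ i → sum (g i))
  regroup : ∀ s d k p → s * s * (d * d * k * p) ≡ s * d * (s * d) * k * p
  regroup = solve-∀
  T²≤ : ∀ j → T j * T j ≤ B
  T²≤ j = begin
    T j * T j
      ≤⟨ ∑-cauchy-schwarz M (g zero) (g (suc j)) X M²≤ ⟩
    X * (sum (g zero) * sum (g (suc j)))
      ≡⟨ absorb (perfectMatchings m) K (∏ (λ i → sum (g′ i))) (sum (g zero)) (sum (g (suc j))) ⟩
    perfectMatchings m * perfectMatchings m * K * (sum (g zero) * (sum (g (suc j)) * ∏ (λ i → sum (g′ i))))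
      ≡⟨ cong (λ p → perfectMatchings m * perfectMatchings m * K * (sum (g zero) * p))
              (∏-remove {i = j} (λ i → sum (g (suc i)))) ⟨
    B ∎
    where
    g′ : Fin m → Fin σ → ℕ
    g′ i = g (suc (punchIn j i))
    X = perfectMatchings m * perfectMatchings m * K * ∏ (λ i → sum (g′ i))
    M : Fin σ → ℕ
    M α = ∑ᵛ m (λ b → letterMatchings b * N (α ∷ insertAt b j α))
    absorb : ∀ d k p x y → d * d * k * p * (x * y) ≡ d * d * k * (x * (y * p))
    absorb = solve-∀
    shift : ∀ d k x y p → d * d * (k * (x * y)) * p ≡ d * d * k * p * (x * y)
    shift = solve-∀
    M²≤ : ∀ α → M α * M α ≤ X * (g zero α * g (suc j) α)
    M²≤ α = ≤-trans (letterMatchings-bound m (K * (g zero α * g (suc j) α)) g′ (λ b → N (α ∷ insertAt b j α)) N′²≤)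
                    (≤-reflexive (shift (perfectMatchings m) K (g zero α) (g (suc j) α) (∏ (λ i → sum (g′ i)))))
      where
      N′²≤ : ∀ b → N (α ∷ insertAt b j α) * N (α ∷ insertAt b j α) ≤
                   K * (g zero α * g (suc j) α) * ∏ (λ i → g′ i (lookup b i))
      N′²≤ b = ≤-trans (N²≤ (α ∷ insertAt b j α)) (≤-reflexive (begin-equality
        K * (g zero α * ∏ (λ i → g (suc i) (lookup (insertAt b j α) i)))
          ≡⟨ cong (λ p → K * (g zero α * p)) (∏-insertAt (λ i → g (suc i)) b j α) ⟩
        K * (g zero α * (g (suc j) α * ∏ (λ i → g′ i (lookup b i))))
          ≡⟨ trans (cong (K *_) (sym (*-assoc (g zero α) _ _))) (sym (*-assoc K _ _)) ⟩
        K * (g zero α * g (suc j) α) * ∏ (λ i → g′ i (lookup b i))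
          ∎))

module _ {a p} {A : Set a} {P : Pred A p} (P? : Decidable P) where

  count-∷ : ∀ {n} x (xs : Vec A n) → count P? (x ∷ xs) ≡ iverson (P? x) + count P? xs
  count-∷ x xs with does (P? x)
  ... | true  = refl
  ... | false = refl

  count-removeAt : ∀ {m} (v : Vec A (suc m)) j →
                   count P? v ≡ iverson (P? (lookup v j)) + count P? (removeAt v j)
  count-removeAt (x ∷ v)     zero    = count-∷ x v
  count-removeAt (x ∷ y ∷ v) (suc j) = begin
    count P? (x ∷ y ∷ v)                                   ≡⟨ count-∷ x (y ∷ v) ⟩
    iverson (P? x) + count P? (y ∷ v)                      ≡⟨ cong (iverson (P? x) +_) (count-removeAt (y ∷ v) j) ⟩
    iverson (P? x) + (iverson (P? z) + count P? w)         ≡⟨ +-comm-middle (iverson (P? x)) (iverson (P? z)) (count P? w) ⟩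
    iverson (P? z) + (iverson (P? x) + count P? w)         ≡⟨ cong (iverson (P? z) +_) (sym (count-∷ x w)) ⟩
    iverson (P? z) + count P? (x ∷ w)                      ∎
    where
    open ≡-Reasoning
    z = lookup (y ∷ v) j
    w = removeAt (y ∷ v) j
    +-comm-middle : ∀ i j k → i + (j + k) ≡ j + (i + k)
    +-comm-middle = solve-∀

  count-pos⇒∃-lookup : ∀ {n} (v : Vec A n) → 1 ≤ count P? v → ∃ λ j → P (lookup v j)
  count-pos⇒∃-lookup (x ∷ v) pos with P? x
  ... | yes px = zero , px
  ... | no _   = let j , pj = count-pos⇒∃-lookup v pos in suc j , pj

EvenCounts : ∀ {σ n} → Vec (Fin σ) n → Set
EvenCounts {σ} v = (β : Fin σ) → count (_≟F β) v % 2 ≡ 0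

count-self : ∀ {σ n} (α : Fin σ) (v : Vec (Fin σ) n) → count (_≟F α) (α ∷ v) ≡ suc (count (_≟F α) v)
count-self α v = trans (count-∷ (_≟F α) α v) (cong (_+ count (_≟F α) v) (≡⇒iverson-≟≡1 {α = α} refl))

[1+k]%2≡0⇒1≤k : ∀ k → suc k % 2 ≡ 0 → 1 ≤ k
[1+k]%2≡0⇒1≤k zero    ()
[1+k]%2≡0⇒1≤k (suc k) _ = s≤s z≤n

evenCounts-partner : ∀ {σ n} {α : Fin σ} (v : Vec (Fin σ) n) → EvenCounts (α ∷ v) → ∃ λ j → lookup v j ≡ α
evenCounts-partner {α = α} v even =
  count-pos⇒∃-lookup (_≟F α) v ([1+k]%2≡0⇒1≤k _ (subst (λ k → k % 2 ≡ 0) (count-self α v) (even α)))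

evenCounts-removeAt : ∀ {σ m} {α : Fin σ} (v : Vec (Fin σ) (suc m)) j → lookup v j ≡ α →
                      EvenCounts (α ∷ v) → EvenCounts (removeAt v j)
evenCounts-removeAt {α = α} v j vj≡α even β = begin
  count (_≟F β) w % 2                         ≡⟨ [m+kn]%n≡m%n (count (_≟F β) w) (iverson (α ≟F β)) 2 ⟨
  (count (_≟F β) w + iverson (α ≟F β) * 2) % 2 ≡⟨ cong (_% 2) pair-removed ⟩
  count (_≟F β) (α ∷ v) % 2                   ≡⟨ even β ⟩
  0                                           ∎
  where
  open ≡-Reasoning
  w = removeAt v j
  twice : ∀ c i → c + i * 2 ≡ i + (i + c)
  twice = solve-∀
  pair-removed : count (_≟F β) w + iverson (α ≟F β) * 2 ≡ count (_≟F β) (α ∷ v)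
  pair-removed = begin
    count (_≟F β) w + iverson (α ≟F β) * 2
      ≡⟨ twice (count (_≟F β) w) (iverson (α ≟F β)) ⟩
    iverson (α ≟F β) + (iverson (α ≟F β) + count (_≟F β) w)
      ≡⟨ cong (λ γ → iverson (α ≟F β) + (iverson (γ ≟F β) + count (_≟F β) w)) vj≡α ⟨
    iverson (α ≟F β) + (iverson (lookup v j ≟F β) + count (_≟F β) w)
      ≡⟨ cong (iverson (α ≟F β) +_) (count-removeAt (_≟F β) v j) ⟨
    iverson (α ≟F β) + count (_≟F β) v
      ≡⟨ count-∷ (_≟F β) α v ⟨
    count (_≟F β) (α ∷ v)
      ∎

evenCounts⇒letterMatchings-pos : ∀ {σ} n (v : Vec (Fin σ) n) → EvenCounts v → 1 ≤ letterMatchings v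
evenCounts⇒letterMatchings-pos zero          []      even = ≤-refl
evenCounts⇒letterMatchings-pos (suc zero)    (α ∷ []) even =
  [1+k]%2≡0⇒1≤k 0 (subst (λ k → k % 2 ≡ 0) (count-self α []) (even α))
evenCounts⇒letterMatchings-pos (suc (suc m)) (α ∷ v) even
  with j , vj≡α ← evenCounts-partner {α = α} v even = begin
  1
    ≤⟨ evenCounts⇒letterMatchings-pos m (removeAt v j) (evenCounts-removeAt v j vj≡α even) ⟩
  letterMatchings (removeAt v j)
    ≡⟨ *-identityˡ _ ⟨
  1 * letterMatchings (removeAt v j)
    ≡⟨ cong (_* letterMatchings (removeAt v j)) (≡⇒iverson-≟≡1 vj≡α) ⟨
  iverson (lookup v j ≟F α) * letterMatchings (removeAt v j)
    ≤⟨ term≤∑ (λ i → iverson (lookup v i ≟F α) * letterMatchings (removeAt v i)) j ⟩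
  letterMatchings (α ∷ v)
    ∎
  where
  open ≤-Reasoning

∑ₗ : ∀ {A : Set} → List A → (A → ℕ) → ℕ
∑ₗ []       f = 0
∑ₗ (x ∷ xs) f = f x + ∑ₗ xs f

syntax ∑ₗ xs (λ x → e) = ∑[ x ∈ xs ] e

module _ {A : Set} where

  ∑ₗ-cong : (xs : List A) {f g : A → ℕ} → (∀ x → f x ≡ g x) → ∑ₗ xs f ≡ ∑ₗ xs g
  ∑ₗ-cong []       f≡g = refl
  ∑ₗ-cong (x ∷ xs) f≡g = cong₂ _+_ (f≡g x) (∑ₗ-cong xs f≡g)

  ∑ₗ-mono-≤ : (xs : List A) {f g : A → ℕ} → (∀ x → f x ≤ g x) → ∑ₗ xs f ≤ ∑ₗ xs g
  ∑ₗ-mono-≤ []       f≤g = z≤n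
  ∑ₗ-mono-≤ (x ∷ xs) f≤g = +-mono-≤ (f≤g x) (∑ₗ-mono-≤ xs f≤g)

  ∑ₗ-++ : (xs ys : List A) (f : A → ℕ) → ∑ₗ (xs ++ ys) f ≡ ∑ₗ xs f + ∑ₗ ys f
  ∑ₗ-++ []       ys f = refl
  ∑ₗ-++ (x ∷ xs) ys f = trans (cong (f x +_) (∑ₗ-++ xs ys f)) (sym (+-assoc (f x) _ _))

  ∑ₗ-*ˡ : (xs : List A) (k : ℕ) (f : A → ℕ) → ∑[ x ∈ xs ] (k * f x) ≡ k * ∑ₗ xs f
  ∑ₗ-*ˡ []       k f = sym (*-zeroʳ k)
  ∑ₗ-*ˡ (x ∷ xs) k f = trans (cong (k * f x +_) (∑ₗ-*ˡ xs k f)) (sym (*-distribˡ-+ k (f x) _))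

  ∑ₗ-const : (xs : List A) (k : ℕ) → ∑[ x ∈ xs ] k ≡ length xs * k
  ∑ₗ-const []       k = refl
  ∑ₗ-const (x ∷ xs) k = cong (k +_) (∑ₗ-const xs k)

  length-filter≡∑ₗ : ∀ {p} {P : Pred A p} (P? : Decidable P) (xs : List A) →
                     length (filter P? xs) ≡ ∑[ x ∈ xs ] iverson (P? x)
  length-filter≡∑ₗ P? []       = refl
  length-filter≡∑ₗ P? (x ∷ xs) with does (P? x)
  ... | true  = cong suc (length-filter≡∑ₗ P? xs)
  ... | false = length-filter≡∑ₗ P? xs

  ∑ₗ-filter-∷ : ∀ {p} {P : Pred A p} (P? : Decidable P) x (xs : List A) (f : A → ℕ) →
                ∑ₗ (filter P? (x ∷ xs)) f ≡ iverson (P? x) * f x + ∑ₗ (filter P? xs) f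
  ∑ₗ-filter-∷ P? x xs f with does (P? x)
  ... | true  = cong (_+ ∑ₗ (filter P? xs) f) (sym (+-identityʳ (f x)))
  ... | false = refl

  ∑ᵛ-∑ₗ-comm : ∀ {σ} n (xs : List A) (f : A → Vec (Fin σ) n → ℕ) →
               ∑ᵛ n (λ v → ∑[ x ∈ xs ] f x v) ≡ ∑[ x ∈ xs ] ∑ᵛ n (f x)
  ∑ᵛ-∑ₗ-comm zero    xs f = refl
  ∑ᵛ-∑ₗ-comm {σ} (suc n) xs f =
    trans (sum-cong-≗ (λ α → ∑ᵛ-∑ₗ-comm n xs (λ x v → f x (α ∷ v)))) (∑-∑ₗ-comm xs)
    where
    ∑-∑ₗ-comm : (ys : List A) →
                ∑[ α < σ ] ∑[ x ∈ ys ] ∑ᵛ n (λ v → f x (α ∷ v)) ≡ ∑[ x ∈ ys ] ∑ᵛ (suc n) (f x)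
    ∑-∑ₗ-comm []       = sum-replicate-zero σ
    ∑-∑ₗ-comm (y ∷ ys) = trans (∑-distrib-+ (λ α → ∑ᵛ n (λ v → f y (α ∷ v))) _)
                               (cong (∑ᵛ (suc n) (f y) +_) (∑-∑ₗ-comm ys))

  ∑ₗ-partition : ∀ {σ} (h : A → Fin σ) (f : Fin σ → A → ℕ) (xs : List A) →
                 ∑[ x ∈ xs ] f (h x) x ≡ ∑[ α < σ ] ∑ₗ (filter (λ x → h x ≟F α) xs) (f α)
  ∑ₗ-partition {σ} h f []       = sym (sum-replicate-zero σ)
  ∑ₗ-partition {σ} h f (x ∷ xs) = sym (begin
    ∑[ α < σ ] ∑ₗ (filter (λ y → h y ≟F α) (x ∷ xs)) (f α)
      ≡⟨ sum-cong-≗ (λ α → ∑ₗ-filter-∷ (λ y → h y ≟F α) x xs (f α)) ⟩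
    ∑[ α < σ ] (iverson (h x ≟F α) * f α x + ∑ₗ (filter (λ y → h y ≟F α) xs) (f α))
      ≡⟨ ∑-distrib-+ (λ α → iverson (h x ≟F α) * f α x) _ ⟩
    ∑[ α < σ ] (iverson (h x ≟F α) * f α x) + ∑[ α < σ ] ∑ₗ (filter (λ y → h y ≟F α) xs) (f α)
      ≡⟨ cong₂ _+_ (∑-select (h x) (λ α → f α x)) (sym (∑ₗ-partition h f xs)) ⟩
    f (h x) x + ∑[ y ∈ xs ] f (h y) y
      ∎)
    where open ≡-Reasoning

module _ {A B : Set} where

  ∑ₗ-map : (g : A → B) (xs : List A) (f : B → ℕ) → ∑ₗ (map g xs) f ≡ ∑[ x ∈ xs ] f (g x)
  ∑ₗ-map g []       f = refl
  ∑ₗ-map g (x ∷ xs) f = cong (f (g x) +_) (∑ₗ-map g xs f)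

  ∑ₗ-concatMap : (g : A → List B) (xs : List A) (f : B → ℕ) →
                 ∑ₗ (L.concatMap g xs) f ≡ ∑[ x ∈ xs ] ∑ₗ (g x) f
  ∑ₗ-concatMap g []       f = refl
  ∑ₗ-concatMap g (x ∷ xs) f =
    trans (∑ₗ-++ (g x) (L.concatMap g xs) f) (cong (∑ₗ (g x) f +_) (∑ₗ-concatMap g xs f))

∑ₗ-1 : ∀ {A : Set} (xs : List A) → ∑[ x ∈ xs ] 1 ≡ length xs
∑ₗ-1 []       = refl
∑ₗ-1 (x ∷ xs) = cong suc (∑ₗ-1 xs)

∑ₗ-tuples : ∀ {K : Set} {n} (A : Fin (suc n) → List K) (F : Vec K (suc n) → ℕ) →
            ∑ₗ (tuples A) F ≡ ∑[ x ∈ A zero ] ∑[ xs ∈ tuples (λ i → A (suc i)) ] F (x ∷ xs)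
∑ₗ-tuples A F = trans (∑ₗ-concatMap _ (A zero) F)
                      (∑ₗ-cong (A zero) (λ x → ∑ₗ-map (x ∷_) (tuples (λ i → A (suc i))) F))

length-tuples : ∀ {K : Set} n (A : Fin n → List K) → length (tuples A) ≡ ∏ (λ i → length (A i))
length-tuples zero    A = refl
length-tuples (suc n) A = begin
  length (tuples A)                           ≡⟨ ∑ₗ-1 (tuples A) ⟨
  ∑[ xs ∈ tuples A ] 1                        ≡⟨ ∑ₗ-tuples A (λ _ → 1) ⟩
  ∑[ x ∈ A zero ] ∑[ xs ∈ tuples A′ ] 1       ≡⟨ ∑ₗ-cong (A zero) (λ _ → ∑ₗ-1 (tuples A′)) ⟩
  ∑[ x ∈ A zero ] length (tuples A′)          ≡⟨ ∑ₗ-const (A zero) (length (tuples A′)) ⟩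
  length (A zero) * length (tuples A′)        ≡⟨ cong (length (A zero) *_) (length-tuples n A′) ⟩
  length (A zero) * ∏ (λ i → length (A′ i))   ∎
  where
  open ≡-Reasoning
  A′ = λ i → A (suc i)

sizeProduct≡∏ : ∀ {K : Set} n (A : Fin n → List K) → sizeProduct A ≡ ∏ (λ i → length (A i))
sizeProduct≡∏ zero    A = refl
sizeProduct≡∏ (suc n) A = cong (length (A zero) *_) (sizeProduct≡∏ n (λ i → A (suc i)))

module _ {σ c : ℕ} where

  withHead : List (Key σ (suc c)) → Fin σ → List (Key σ (suc c))
  withHead xs α = filter (λ x → head x ≟F α) xs

  byHead : ∀ {n} → (Fin n → List (Key σ (suc c))) → Vec (Fin σ) n → Fin n → List (Key σ c)
  byHead A a i = map tail (withHead (A i) (lookup a i))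

  sizeProduct-byHead : ∀ n (A : Fin n → List (Key σ (suc c))) a →
                       sizeProduct (byHead A a) ≡ ∏ (λ i → length (withHead (A i) (lookup a i)))
  sizeProduct-byHead n A a =
    trans (sizeProduct≡∏ n (byHead A a)) (∏-cong (λ i → length-map tail (withHead (A i) (lookup a i))))

  ∑-length-withHead : (xs : List (Key σ (suc c))) → ∑[ α < σ ] length (withHead xs α) ≡ length xs
  ∑-length-withHead xs = begin
    ∑[ α < σ ] length (withHead xs α)     ≡⟨ sum-cong-≗ (λ α → ∑ₗ-1 (withHead xs α)) ⟨
    ∑[ α < σ ] ∑[ x ∈ withHead xs α ] 1   ≡⟨ ∑ₗ-partition head (λ _ _ → 1) xs ⟨
    ∑[ x ∈ xs ] 1                         ≡⟨ ∑ₗ-1 xs ⟩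
    length xs                             ∎
    where open ≡-Reasoning

  map-∷-tail : ∀ α (xs : List (Key σ (suc c))) → All (λ x → head x ≡ α) xs → map (α ∷_) (map tail xs) ≡ xs
  map-∷-tail α []              []           = refl
  map-∷-tail α ((.α ∷ r) ∷ xs) (refl ∷ hxs) = cong ((α ∷ r) ∷_) (map-∷-tail α xs hxs)

  unique-byHead : ∀ {n} (A : Fin n → List (Key σ (suc c))) a i → Unique (A i) → Unique (byHead A a i)
  unique-byHead A a i u =
    map⁻ (subst Unique (sym (map-∷-tail (lookup a i) _ (all-filter P? (A i)))) (filter⁺ P? u))
    where P? = λ x → head x ≟F lookup a i

  ∑ₗ-tuples-heads-tails : ∀ n (A : Fin n → List (Key σ (suc c))) (F : Vec (Fin σ) n → Vec (Key σ c) n → ℕ) →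
    ∑[ xs ∈ tuples A ] F (V.map head xs) (V.map tail xs) ≡ ∑ᵛ n (λ a → ∑ₗ (tuples (byHead A a)) (F a))
  ∑ₗ-tuples-heads-tails zero    A F = refl
  ∑ₗ-tuples-heads-tails (suc n) A F = begin
    ∑[ xs ∈ tuples A ] F (V.map head xs) (V.map tail xs)
      ≡⟨ ∑ₗ-tuples A _ ⟩
    ∑[ x ∈ A zero ] ∑[ xs ∈ tuples A′ ] F (head x ∷ V.map head xs) (tail x ∷ V.map tail xs)
      ≡⟨ ∑ₗ-cong (A zero) (λ x → ∑ₗ-tuples-heads-tails n A′ (λ a ys → F (head x ∷ a) (tail x ∷ ys))) ⟩
    ∑[ x ∈ A zero ] Φ (head x) x
      ≡⟨ ∑ₗ-partition head Φ (A zero) ⟩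
    ∑[ α < σ ] ∑ₗ (withHead (A zero) α) (Φ α)
      ≡⟨ sum-cong-≗ (λ α → ∑ₗ-map tail (withHead (A zero) α) (λ y → ∑ᵛ n (λ a → G α a y))) ⟨
    ∑[ α < σ ] ∑[ y ∈ map tail (withHead (A zero) α) ] ∑ᵛ n (λ a → G α a y)
      ≡⟨ sum-cong-≗ (λ α → ∑ᵛ-∑ₗ-comm n (map tail (withHead (A zero) α)) (λ y a → G α a y)) ⟨
    ∑[ α < σ ] ∑ᵛ n (λ a → ∑[ y ∈ map tail (withHead (A zero) α) ] G α a y)
      ≡⟨ sum-cong-≗ (λ α → ∑ᵛ-cong n (λ a → ∑ₗ-tuples (byHead A (α ∷ a)) (F (α ∷ a)))) ⟨
    ∑ᵛ (suc n) (λ a → ∑ₗ (tuples (byHead A a)) (F a))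
      ∎
    where
    open ≡-Reasoning
    A′ = λ i → A (suc i)
    G : Fin σ → Vec (Fin σ) n → Key σ c → ℕ
    G α a y = ∑[ ys ∈ tuples (byHead A′ a) ] F (α ∷ a) (y ∷ ys)
    Φ : Fin σ → Key σ (suc c) → ℕ
    Φ α x = ∑ᵛ n (λ a → G α a (tail x))

  mult-head : ∀ {n} (xs : Vec (Key σ (suc c)) n) α → mult xs zero α ≡ count (_≟F α) (V.map head xs)
  mult-head []             α = refl
  mult-head ((β ∷ _) ∷ xs) α with β ≟F α
  ... | yes _ = cong suc (mult-head xs α)
  ... | no _  = mult-head xs α

  mult-tail : ∀ {n} (xs : Vec (Key σ (suc c)) n) j α → mult xs (suc j) α ≡ mult (V.map tail xs) j α
  mult-tail []             j α = refl
  mult-tail ((_ ∷ x) ∷ xs) j α with lookup x j ≟F α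
  ... | yes _ = cong suc (mult-tail xs j α)
  ... | no _  = mult-tail xs j α

  xorEmpty-heads : ∀ {n} (xs : Vec (Key σ (suc c)) n) → XorEmpty xs → EvenCounts (V.map head xs)
  xorEmpty-heads xs empty α = trans (cong (_% 2) (sym (mult-head xs α))) (empty zero α)

  xorEmpty-tails : ∀ {n} (xs : Vec (Key σ (suc c)) n) → XorEmpty xs → XorEmpty (V.map tail xs)
  xorEmpty-tails xs empty j α = trans (cong (_% 2) (sym (mult-tail xs j α))) (empty (suc j) α)

  iverson-xorEmpty≤ : ∀ {n} (xs : Vec (Key σ (suc c)) n) →
    iverson (xorEmpty? xs) ≤ letterMatchings (V.map head xs) * iverson (xorEmpty? (V.map tail xs))
  iverson-xorEmpty≤ {n} xs = bound (xorEmpty? xs) (xorEmpty? (V.map tail xs))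
    where
    bound : (d : Dec (XorEmpty xs)) (d′ : Dec (XorEmpty (V.map tail xs))) →
            iverson d ≤ letterMatchings (V.map head xs) * iverson d′
    bound (no _)      _            = z≤n
    bound (yes empty) (no ¬empty′) = ⊥-elim (¬empty′ (xorEmpty-tails xs empty))
    bound (yes empty) (yes _)      = subst (1 ≤_) (sym (*-identityʳ _))
                                           (evenCounts⇒letterMatchings-pos n _ (xorEmpty-heads xs empty))

  zeroTupleCount≤∑ᵛ : ∀ n (A : Fin n → List (Key σ (suc c))) →
    zeroTupleCount A ≤ ∑ᵛ n (λ a → letterMatchings a * zeroTupleCount (byHead A a))
  zeroTupleCount≤∑ᵛ n A = begin
    zeroTupleCount A
      ≡⟨ length-filter≡∑ₗ xorEmpty? (tuples A) ⟩
    ∑[ xs ∈ tuples A ] iverson (xorEmpty? xs)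
      ≤⟨ ∑ₗ-mono-≤ (tuples A) iverson-xorEmpty≤ ⟩
    ∑[ xs ∈ tuples A ] (letterMatchings (V.map head xs) * iverson (xorEmpty? (V.map tail xs)))
      ≡⟨ ∑ₗ-tuples-heads-tails n A (λ a ys → letterMatchings a * iverson (xorEmpty? ys)) ⟩
    ∑ᵛ n (λ a → ∑[ ys ∈ tuples (byHead A a) ] (letterMatchings a * iverson (xorEmpty? ys)))
      ≡⟨ ∑ᵛ-cong n (λ a → ∑ₗ-*ˡ (tuples (byHead A a)) (letterMatchings a) (λ ys → iverson (xorEmpty? ys))) ⟩
    ∑ᵛ n (λ a → letterMatchings a * ∑[ ys ∈ tuples (byHead A a) ] iverson (xorEmpty? ys))
      ≡⟨ ∑ᵛ-cong n (λ a → cong (letterMatchings a *_) (length-filter≡∑ₗ xorEmpty? (tuples (byHead A a)))) ⟨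
    ∑ᵛ n (λ a → letterMatchings a * zeroTupleCount (byHead A a))
      ∎
    where open ≤-Reasoning

unique-keyless : ∀ {σ} (xs : List (Key σ 0)) → Unique xs → length xs ≤ 1
unique-keyless []               _                  = z≤n
unique-keyless ([] ∷ [])        _                  = ≤-refl
unique-keyless ([] ∷ [] ∷ _)    ((≢[] ∷ _) ∷ _)    = ⊥-elim (≢[] refl)

∏≤1 : ∀ {n} (f : Fin n → ℕ) → (∀ i → f i ≤ 1) → ∏ f ≤ 1
∏≤1 {zero}  f f≤1 = ≤-refl
∏≤1 {suc n} f f≤1 = *-mono-≤ (f≤1 zero) (∏≤1 (λ i → f (suc i)) (λ i → f≤1 (suc i)))

zeroTupleCount-keyless : ∀ {σ} n (A : Fin n → List (Key σ 0)) → (∀ i → Unique (A i)) →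
                         zeroTupleCount A * zeroTupleCount A ≤ sizeProduct A
zeroTupleCount-keyless n A u = begin
  zeroTupleCount A * zeroTupleCount A ≤⟨ *-monoʳ-≤ (zeroTupleCount A) (≤-trans count≤size size≤1) ⟩
  zeroTupleCount A * 1                ≡⟨ *-identityʳ _ ⟩
  zeroTupleCount A                    ≤⟨ count≤size ⟩
  sizeProduct A                       ∎
  where
  open ≤-Reasoning
  count≤size : zeroTupleCount A ≤ sizeProduct A
  count≤size = ≤-trans (length-filter xorEmpty? (tuples A))
                       (≤-reflexive (trans (length-tuples n A) (sym (sizeProduct≡∏ n A))))
  size≤1 : sizeProduct A ≤ 1
  size≤1 = subst (_≤ 1) (sym (sizeProduct≡∏ n A)) (∏≤1 _ (λ i → unique-keyless (A i) (u i)))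

zeroTupleCount-bound : ∀ {σ} c n (A : Fin n → List (Key σ c)) → (∀ i → Unique (A i)) →
  zeroTupleCount A * zeroTupleCount A ≤ perfectMatchings n ^ c * perfectMatchings n ^ c * sizeProduct A
zeroTupleCount-bound zero n A u =
  ≤-trans (zeroTupleCount-keyless n A u) (≤-reflexive (sym (*-identityˡ (sizeProduct A))))
zeroTupleCount-bound {σ} (suc c) n A u = begin
  zeroTupleCount A * zeroTupleCount A
    ≤⟨ *-mono-≤ (zeroTupleCount≤∑ᵛ n A) (zeroTupleCount≤∑ᵛ n A) ⟩
  ∑ᵛ n (λ a → letterMatchings a * N a) * ∑ᵛ n (λ a → letterMatchings a * N a)
    ≤⟨ letterMatchings-bound n K g N N²≤ ⟩
  D * D * K * ∏ (λ i → sum (g i))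
    ≡⟨ cong (D * D * K *_) (trans (∏-cong (λ i → ∑-length-withHead (A i))) (sym (sizeProduct≡∏ n A))) ⟩
  D * D * K * sizeProduct A
    ≡⟨ regroup D (D ^ c) (sizeProduct A) ⟩
  D ^ suc c * D ^ suc c * sizeProduct A
    ∎
  where
  open ≤-Reasoning
  D = perfectMatchings n
  K = D ^ c * D ^ c
  N : Vec (Fin σ) n → ℕ
  N a = zeroTupleCount (byHead A a)
  g : Fin n → Fin σ → ℕ
  g i α = length (withHead (A i) α)
  regroup : ∀ d e p → d * d * (e * e) * p ≡ d * e * (d * e) * p
  regroup = solve-∀
  N²≤ : ∀ a → N a * N a ≤ K * ∏ (λ i → g i (lookup a i))
  N²≤ a = ≤-trans (zeroTupleCount-bound c n (byHead A a) (λ i → unique-byHead A a i (u i)))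
                  (≤-reflexive (cong (K *_) (sizeProduct-byHead n A a)))

lemma13 : (σ c t : ℕ) (A : Fin (2 * t) → List (Key σ c)) →
          (∀ i → Unique (A i)) →
          zeroTupleCount A ^ 2 ≤ (oddDoubleFact t ^ c) ^ 2 * sizeProduct A
lemma13 σ c t A u = begin
  zeroTupleCount A ^ 2
    ≡⟨ square (zeroTupleCount A) ⟩
  zeroTupleCount A * zeroTupleCount A
    ≤⟨ zeroTupleCount-bound c (2 * t) A u ⟩
  perfectMatchings (2 * t) ^ c * perfectMatchings (2 * t) ^ c * sizeProduct A
    ≡⟨ cong (λ d → d ^ c * d ^ c * sizeProduct A) (perfectMatchings-even t) ⟩
  oddDoubleFact t ^ c * oddDoubleFact t ^ c * sizeProduct A
    ≡⟨ cong (_* sizeProduct A) (square (oddDoubleFact t ^ c)) ⟨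
  (oddDoubleFact t ^ c) ^ 2 * sizeProduct A
    ∎
  where
  open ≤-Reasoning
  square : ∀ x → x ^ 2 ≡ x * x
  square x = cong (x *_) (*-identityʳ x)
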